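{- Let $(C,\sqsubseteq)$ be a complete lattice, $b\colon C\to C$ a monotone map and $a\colon C\to C$ an up-closure operator. Then $a$ is $b$-complete if and only if for every $f\in Pre(a)$, $a$ is $(b,f)$-complete.
   Context: An up-closure operator is a monotone $a$ with $x\sqsubseteq a(x)$ and $a(a(x))\sqsubseteq a(x)$. $Pre(a)=\{x\in C\mid a(x)\sqsubseteq x\}$, a complete lattice with the order of $C$; $\alpha\colon C\to Pre(a)$, $\alpha(x)=a(x)$; $\gamma\colon Pre(a)\to C$ the inclusion. $a$ is $b$-complete iff $\alpha(\mu b)=\mu(\alpha\circ b\circ\gamma)$ (the latter least fixed point taken in $Pre(a)$). $a$ is $(b,f)$-complete iff (1) $a(f)\sqsubseteq f$ and (2) $\mu(a\circ b)\sqsubseteq f$ iff $\mu b\sqsubseteq f$. -}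

module Defs where

open import Level using (Level; suc)
open import Data.Product using (Σ; _×_; _,_; proj₁)
open import Function.Bundles using (_⇔_)
open import Relation.Unary using (Pred)
open import Relation.Binary.Bundles using (Poset)
open import Relation.Binary.Core using (Rel)

record CompleteLattice (ℓ : Level) : Set (suc ℓ) where
  field
    poset : Poset ℓ ℓ ℓ
  open Poset poset public
  field
    ⋀         : Pred Carrier ℓ → Carrier
    ⋀-lower   : (S : Pred Carrier ℓ) → ∀ {x} → S x → ⋀ S ≤ x
    ⋀-greatest : (S : Pred Carrier ℓ) → ∀ {y} → (∀ {x} → S x → y ≤ x) → y ≤ ⋀ S

module _ {ℓ : Level} (L : CompleteLattice ℓ) where
  open CompleteLattice L

  Monotone : (Carrier → Carrier) → Set ℓ
  Monotone f = ∀ {x y} → x ≤ y → f x ≤ f y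

  record UpClosure (a : Carrier → Carrier) : Set ℓ where
    field
      monotone   : Monotone a
      extensive  : ∀ x → x ≤ a x
      idempotent : ∀ x → a (a x) ≤ a x

IsLeastFixedPoint : ∀ {ℓ} {A : Set ℓ} (_≈_ _≤_ : Rel A ℓ) → (A → A) → A → Set ℓ
IsLeastFixedPoint _≈_ _≤_ f m = (f m ≈ m) × (∀ x → f x ≈ x → m ≤ x)

module _ {ℓ : Level} (L : CompleteLattice ℓ) where
  open CompleteLattice L

  module PreLattice (a : Carrier → Carrier) (ac : UpClosure L a) where
    open UpClosure ac

    Pre : Set ℓ
    Pre = Σ Carrier (λ x → a x ≤ x)

    _≈ₚ_ : Rel Pre ℓ
    p ≈ₚ q = proj₁ p ≈ proj₁ q

    _≤ₚ_ : Rel Pre ℓ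
    p ≤ₚ q = proj₁ p ≤ proj₁ q

    α : Carrier → Pre
    α x = a x , idempotent x

    γ : Pre → Carrier
    γ = proj₁

  -- a is b-complete: α(μ b) = μ(α ∘ b ∘ γ), the latter taken in Pre(a).
  -- Least fixed points exist in C and in Pre(a) (both complete lattices),
  -- so we quantify over them.
  IsComplete : (a : Carrier → Carrier) → UpClosure L a → (b : Carrier → Carrier) → Set ℓ
  IsComplete a ac b =
    ∀ m → IsLeastFixedPoint _≈_ _≤_ b m →
    ∀ n → IsLeastFixedPoint _≈ₚ_ _≤ₚ_ (λ p → α (b (γ p))) n →
    α m ≈ₚ n
    where open PreLattice a ac

  IsCompleteAt : (a : Carrier → Carrier) → (b : Carrier → Carrier) → Carrier → Set ℓ
  IsCompleteAt a b f =
    (a f ≤ f) ×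
    (∀ m → IsLeastFixedPoint _≈_ _≤_ (λ x → a (b x)) m →
     ∀ n → IsLeastFixedPoint _≈_ _≤_ b n →
     (m ≤ f ⇔ n ≤ f))

module Submission where

-- Two general facts about an up-closure a carry the proof.
--  * a x is the least element of Pre(a) above x; hence, for y ∈ Pre(a),
--    a x = y holds exactly when x and y have the same upper bounds in Pre(a)
--    (`closure-≈⇔sameUpperBounds`).
--  * Every fixed point of a ∘ b lies in Pre(a), so least fixed points of
--    α ∘ b ∘ γ in Pre(a) are the same thing as least fixed points of a ∘ b
--    in C.  Consequently b-completeness says a(μ b) = μ(a ∘ b) in C
--    (`complete⇔closure-of-lfp`).
-- Taking x = μ b and y = μ(a ∘ b) in the first fact, "a(μ b) = μ(a ∘ b)"
-- becomes "for all f ∈ Pre(a): μ(a ∘ b) ⊑ f iff μ b ⊑ f", which after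
-- swapping the quantifiers over f and over the least fixed points is
-- (b,f)-completeness for all f ∈ Pre(a).

open import Defs
open import Level using (Level)
open import Function.Bundles using (_⇔_; mk⇔; Equivalence)
open import Data.Product using (_,_; proj₁; proj₂)

open Equivalence using (to; from)

module UpClosureFacts {ℓ : Level} (L : CompleteLattice ℓ)
                      {a : CompleteLattice.Carrier L → CompleteLattice.Carrier L}
                      (ac : UpClosure L a) where
  open CompleteLattice L
  open UpClosure ac
  open PreLattice L a ac

  closure-least : ∀ {x f} → x ≤ f → a f ≤ f → a x ≤ f
  closure-least x≤f af≤f = trans (monotone x≤f) af≤f

  closure-≈⇔sameUpperBounds : ∀ x (y : Pre) →
    a x ≈ proj₁ y ⇔ (∀ (f : Pre) → (proj₁ y ≤ proj₁ f ⇔ x ≤ proj₁ f))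
  closure-≈⇔sameUpperBounds x (y , ay≤y) = mk⇔ sameBounds closureIsY
    where
    sameBounds : a x ≈ y → ∀ (f : Pre) → (y ≤ proj₁ f ⇔ x ≤ proj₁ f)
    sameBounds ax≈y (f , af≤f) = mk⇔
      (λ y≤f → trans (extensive x) (trans (reflexive ax≈y) y≤f))
      (λ x≤f → trans (reflexive (Eq.sym ax≈y)) (closure-least x≤f af≤f))

    -- test the hypothesis against the upper bounds y and a x of Pre(a)
    closureIsY : (∀ (f : Pre) → (y ≤ proj₁ f ⇔ x ≤ proj₁ f)) → a x ≈ y
    closureIsY bounds = antisym
      (closure-least (to (bounds (y , ay≤y)) refl) ay≤y)
      (from (bounds (α x)) (extensive x))

  module _ (b : Carrier → Carrier) where

    fixed-a∘b⇒Pre : ∀ {x} → a (b x) ≈ x → a x ≤ x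
    fixed-a∘b⇒Pre {x} abx≈x = begin
      a x         ≈⟨ Eq.sym (monotone-≈ abx≈x) ⟩
      a (a (b x)) ≤⟨ idempotent (b x) ⟩
      a (b x)     ≈⟨ abx≈x ⟩
      x           ∎
      where
      open import Relation.Binary.Reasoning.PartialOrder poset
      monotone-≈ : ∀ {u v} → u ≈ v → a u ≈ a v
      monotone-≈ u≈v =
        antisym (monotone (reflexive u≈v)) (monotone (reflexive (Eq.sym u≈v)))

    b♯ : Pre → Pre
    b♯ p = α (b (γ p))

    lfpPre⇒lfp : ∀ n → IsLeastFixedPoint _≈ₚ_ _≤ₚ_ b♯ n →
                 IsLeastFixedPoint _≈_ _≤_ (λ x → a (b x)) (proj₁ n)
    lfpPre⇒lfp n (fixed , least) =
      fixed , λ x abx≈x → least (x , fixed-a∘b⇒Pre abx≈x) abx≈x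

    lfp⇒lfpPre : ∀ m (lfp : IsLeastFixedPoint _≈_ _≤_ (λ x → a (b x)) m) →
                 IsLeastFixedPoint _≈ₚ_ _≤ₚ_ b♯ (m , fixed-a∘b⇒Pre (proj₁ lfp))
    lfp⇒lfpPre m (fixed , least) = fixed , λ p → least (proj₁ p)

    complete⇔closure-of-lfp : IsComplete L a ac b ⇔
      (∀ m → IsLeastFixedPoint _≈_ _≤_ b m →
       ∀ n → IsLeastFixedPoint _≈_ _≤_ (λ x → a (b x)) n → a m ≈ n)
    complete⇔closure-of-lfp = mk⇔
      (λ complete m μb n μab →
         complete m μb (n , fixed-a∘b⇒Pre (proj₁ μab)) (lfp⇒lfpPre n μab))
      (λ closure m μb n μb♯ → closure m μb (proj₁ n) (lfpPre⇒lfp n μb♯))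

proposition9p3 : ∀ {ℓ : Level} (L : CompleteLattice ℓ)
                 (b : CompleteLattice.Carrier L → CompleteLattice.Carrier L) → Monotone L b →
                 (a : CompleteLattice.Carrier L → CompleteLattice.Carrier L) → (ac : UpClosure L a) →
                 IsComplete L a ac b ⇔ (∀ (f : PreLattice.Pre L a ac) → IsCompleteAt L a b (proj₁ f))
proposition9p3 L b _ a ac = mk⇔ completeAtAll completeFromAll
  where
  open UpClosureFacts L ac
  open PreLattice L a ac using (Pre)

  -- a(μ b) = μ(a ∘ b), rephrased as equality of upper bounds in Pre(a)
  completeAtAll : IsComplete L a ac b → ∀ (f : Pre) → IsCompleteAt L a b (proj₁ f)
  completeAtAll complete f = proj₂ f , λ m μab n μb →
    to (closure-≈⇔sameUpperBounds n (m , fixed-a∘b⇒Pre b (proj₁ μab)))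
       (to (complete⇔closure-of-lfp b) complete n μb m μab) f

  completeFromAll : (∀ (f : Pre) → IsCompleteAt L a b (proj₁ f)) → IsComplete L a ac b
  completeFromAll completeAt = from (complete⇔closure-of-lfp b) λ m μb n μab →
    from (closure-≈⇔sameUpperBounds m (n , fixed-a∘b⇒Pre b (proj₁ μab)))
         (λ f → proj₂ (completeAt f) n μab m μb)
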